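{- Let $n\ge 2$ be an integer and let $f_0(\Omega_n)$ be the number of vertices of the polytope $\Omega_n$ of $n\times n\times n$ stochastic tensors. Then $f_0(\Omega_n)\geq l_0^{(n-1)^3}(n^3)$, where $l_0^{(n-1)^3}(n^3)$ is the integer $k$ such that $u_0^{(n-1)^3}(k-1)<n^3\leq u_0^{(n-1)^3}(k)$.
   Context: An $n\times n\times n$ stochastic tensor is a real array $A=(a_{ijk})_{1\le i,j,k\le n}$ with $a_{ijk}\ge 0$ for all $i,j,k$, and $\sum_{i} a_{ijk}=1$ for all $j,k$, $\sum_{j} a_{ijk}=1$ for all $i,k$, $\sum_{k} a_{ijk}=1$ for all $i,j$. $\Omega_n\subset\mathbb R^{n^3}$ is the polytope of all such tensors. For a positive integer $d$ and integer $m$, define $$u_0^d(m)=\binom{m-\lfloor \frac{d}{2}\rfloor -1}{\lfloor \frac{d-1}{2}\rfloor}+\binom{m-\lfloor \frac{d-1}{2}\rfloor -1}{\lfloor \frac{d}{2}\rfloor},$$ and for a positive integer $x$ define $l_0^d(x)=k$ if and only if $u_0^d(k-1)<x\leq u_0^d(k)$.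
   Formalization: The entries of the stochastic tensors in Ω_n, including the competing tensors in the extreme-point test defining vertices, are taken in ℚ instead of ℝ. -}

module Defs where

open import Data.Nat as ℕ using (ℕ; zero; suc; _∸_; _⊓_; _≤ᵇ_) renaming (_+_ to _+ℕ_; _<_ to _<ℕ_; _≤_ to _≤ℕ_)
open import Data.Nat.Combinatorics using (_C_)
open import Data.Bool using (if_then_else_)
open import Data.Fin using (Fin; zero; suc)
open import Data.Rational using (ℚ; 0ℚ; 1ℚ; _+_; _*_; _-_; _≤_; _<_)
open import Data.Product using (_×_)
open import Relation.Binary.PropositionalEquality using (_≡_)

half : ℕ → ℕ
half zero = zero
half (suc zero) = zero
half (suc (suc n)) = suc (half n)

-- binomial coefficient binom(m - a - 1, b) for an integer top m - a - 1,
-- with the convention that it is 0 when the top is negative.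
binomShift : ℕ → ℕ → ℕ → ℕ
binomShift m a b = if (suc a ≤ᵇ m) then ((m ∸ suc a) C b) else 0

u0 : ℕ → ℕ → ℕ
u0 d m = binomShift m (half d) (half (d ∸ 1)) +ℕ binomShift m (half (d ∸ 1)) (half d)

Σℚ : (n : ℕ) → (Fin n → ℚ) → ℚ
Σℚ zero f = 0ℚ
Σℚ (suc n) f = f zero + Σℚ n (λ i → f (suc i))

-- n×n×n real (here: rational) arrays
Tensor : ℕ → Set
Tensor n = Fin n → Fin n → Fin n → ℚ

IsStochastic : (n : ℕ) → Tensor n → Set
IsStochastic n A =
  (∀ i j k → 0ℚ ≤ A i j k) ×
  (∀ j k → Σℚ n (λ i → A i j k) ≡ 1ℚ) ×
  (∀ i k → Σℚ n (λ j → A i j k) ≡ 1ℚ) ×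
  (∀ i j → Σℚ n (λ k → A i j k) ≡ 1ℚ)

_≐_ : ∀ {n} → Tensor n → Tensor n → Set
A ≐ B = ∀ i j k → A i j k ≡ B i j k

IsVertex : (n : ℕ) → Tensor n → Set
IsVertex n A = IsStochastic n A ×
  (∀ (B C : Tensor n) (t : ℚ) → IsStochastic n B → IsStochastic n C →
     0ℚ < t → t < 1ℚ →
     (∀ i j k → A i j k ≡ t * B i j k + (1ℚ - t) * C i j k) → B ≐ C)

AtLeastVertices : ℕ → ℕ → Set
AtLeastVertices n k = Data.Product.Σ (Fin k → Tensor n) λ v →
  (∀ a → IsVertex n (v a)) × (∀ a b → v a ≐ v b → a ≡ b)

{-# OPTIONS --safe #-}
module Submission where

-- Every stochastic tensor with entries in {0, 1} is a vertex of Ω_n, because 0 or 1 is a proper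
-- convex combination of two numbers in [0, 1] only if both are equal to it. Such tensors are the
-- permutation tensors A i j k = [i ∙ j = k] of Latin squares ∙ of order n, and the isotopes
-- γ (α i + β j) of the cyclic square ℤ/n, with α, β transposing 1 with a nonzero element and γ
-- transposing 0 with an arbitrary one, are (n - 1)² n distinct Latin squares.
-- On the other side u₀ᵈ is monotone, so k ≤ m as soon as n³ ≤ u₀ᵈ(m), and m = (n - 1)² n will do for
-- n ≥ 3: with d = (n - 1)³ and b = ⌊(d - 1)/2⌋ we have u₀ᵈ(m) ≥ u₀ᵈ(d + 2) ≥ C(b + 2, 2) ≥ d²/8 ≥ n³
-- once n ≥ 4. For n = 2 the hypotheses are contradictory, since u₀¹ ≤ 2 < 8.

open import Defs
open import Data.Fin using (Fin; zero; suc; toℕ)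
open import Data.Nat using (ℕ; zero; suc)
open import Data.Product using (_×_; _,_; proj₁; proj₂)
open import Function using (_∘_; case_of_)
open import Function.Bundles using (_⇔_; mk⇔; _↔_; Equivalence; Inverse; Injection)
open import Relation.Binary.PropositionalEquality
  using (_≡_; refl; sym; trans; cong; cong₂; subst; module ≡-Reasoning)

module LatinSquares where
  open import Data.Nat using (_+_; _*_; _∸_; _%_; NonZero)
  open import Data.Nat.DivMod using (_mod_; %-distribˡ-+; m%n%n≡m%n; %-remove-+ˡ; m<n⇒m%n≡m)
  open import Data.Nat.Properties using (+-comm; +-assoc; m+[n∸m]≡n; m∸n+n≡m; <⇒≤)
  open import Data.Nat.Divisibility using (∣-refl)
  open import Data.Fin.Properties using (toℕ-injective; toℕ-fromℕ<; toℕ<n; suc-injective; *↔×)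
  open import Data.Fin.Permutation using (Permutation′; _⟨$⟩ʳ_; _⟨$⟩ˡ_; transpose; inverseˡ; inverseʳ)
  open import Data.Product.Function.NonDependent.Propositional using (_×-↔_)
  open import Function.Construct.Composition using (_⇔-∘_; _↔-∘_)
  open import Function.Construct.Identity using (↔-id)
  open import Function.Properties.Inverse using (↔⇒↣)

  record LatinSquare (n : ℕ) : Set where
    field
      _∙_ _\\_ _//_ : Fin n → Fin n → Fin n
      ∙≡⇔≡\\ : ∀ {i j k} → i ∙ j ≡ k ⇔ j ≡ i \\ k
      ∙≡⇔≡// : ∀ {i j k} → i ∙ j ≡ k ⇔ i ≡ k // j

  _≈_ : ∀ {n} → LatinSquare n → LatinSquare n → Set
  L ≈ M = ∀ i j → LatinSquare._∙_ L i j ≡ LatinSquare._∙_ M i j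

  ⟨$⟩ʳ≡⇔≡⟨$⟩ˡ : ∀ {n} (π : Permutation′ n) {i j} → π ⟨$⟩ʳ i ≡ j ⇔ i ≡ π ⟨$⟩ˡ j
  ⟨$⟩ʳ≡⇔≡⟨$⟩ˡ π = mk⇔ (λ { refl → sym (inverseˡ π) }) (λ { refl → inverseʳ π })

  isotope : ∀ {n} (α β γ : Permutation′ n) → LatinSquare n → LatinSquare n
  isotope α β γ L = record
    { _∙_ = λ i j → γ ⟨$⟩ʳ ((α ⟨$⟩ʳ i) ∙ (β ⟨$⟩ʳ j))
    ; _\\_ = λ i k → β ⟨$⟩ˡ ((α ⟨$⟩ʳ i) \\ (γ ⟨$⟩ˡ k))
    ; _//_ = λ k j → α ⟨$⟩ˡ ((γ ⟨$⟩ˡ k) // (β ⟨$⟩ʳ j))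
    ; ∙≡⇔≡\\ = ⟨$⟩ʳ≡⇔≡⟨$⟩ˡ β ⇔-∘ (∙≡⇔≡\\ ⇔-∘ ⟨$⟩ʳ≡⇔≡⟨$⟩ˡ γ)
    ; ∙≡⇔≡// = ⟨$⟩ʳ≡⇔≡⟨$⟩ˡ α ⇔-∘ (∙≡⇔≡// ⇔-∘ ⟨$⟩ʳ≡⇔≡⟨$⟩ˡ γ)
    }
    where open LatinSquare L

  module Cyclic (n : ℕ) .{{_ : NonZero n}} where

    _⊕_ _⊖_ : Fin n → Fin n → Fin n
    i ⊕ j = (toℕ i + toℕ j) mod n
    k ⊖ i = ((n ∸ toℕ i) + toℕ k) mod n

    ⊕-comm : ∀ i j → i ⊕ j ≡ j ⊕ i
    ⊕-comm i j = cong (_mod n) (+-comm (toℕ i) (toℕ j))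

    [m+o%n]%n≡[m+o]%n : ∀ m o → (m + o % n) % n ≡ (m + o) % n
    [m+o%n]%n≡[m+o]%n m o = begin
      (m + o % n) % n          ≡⟨ %-distribˡ-+ m (o % n) n ⟩
      (m % n + o % n % n) % n  ≡⟨ cong (λ x → (m % n + x) % n) (m%n%n≡m%n o n) ⟩
      (m % n + o % n) % n      ≡⟨ %-distribˡ-+ m o n ⟨
      (m + o) % n              ∎
      where open ≡-Reasoning

    [a+[b+k]]%n≡k : ∀ a b k → a + b ≡ n → (a + (b + toℕ k)) % n ≡ toℕ k
    [a+[b+k]]%n≡k a b k a+b≡n = begin
      (a + (b + toℕ k)) % n  ≡⟨ cong (_% n) (+-assoc a b (toℕ k)) ⟨
      (a + b + toℕ k) % n    ≡⟨ cong (λ x → (x + toℕ k) % n) a+b≡n ⟩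
      (n + toℕ k) % n        ≡⟨ %-remove-+ˡ (toℕ k) ∣-refl ⟩
      toℕ k % n              ≡⟨ m<n⇒m%n≡m (toℕ<n k) ⟩
      toℕ k                  ∎
      where open ≡-Reasoning

    ⊕-⊖-cancel : ∀ i j → (i ⊕ j) ⊖ i ≡ j
    ⊕-⊖-cancel i j = toℕ-injective (begin
      toℕ ((i ⊕ j) ⊖ i)                       ≡⟨ toℕ-fromℕ< _ ⟩
      ((n ∸ toℕ i) + toℕ (i ⊕ j)) % n         ≡⟨ cong (λ x → ((n ∸ toℕ i) + x) % n) (toℕ-fromℕ< _) ⟩
      ((n ∸ toℕ i) + (toℕ i + toℕ j) % n) % n ≡⟨ [m+o%n]%n≡[m+o]%n (n ∸ toℕ i) _ ⟩
      ((n ∸ toℕ i) + (toℕ i + toℕ j)) % n     ≡⟨ [a+[b+k]]%n≡k (n ∸ toℕ i) (toℕ i) j (m∸n+n≡m (<⇒≤ (toℕ<n i))) ⟩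
      toℕ j                                   ∎)
      where open ≡-Reasoning

    ⊖-⊕-cancel : ∀ i k → i ⊕ (k ⊖ i) ≡ k
    ⊖-⊕-cancel i k = toℕ-injective (begin
      toℕ (i ⊕ (k ⊖ i))                       ≡⟨ toℕ-fromℕ< _ ⟩
      (toℕ i + toℕ (k ⊖ i)) % n               ≡⟨ cong (λ x → (toℕ i + x) % n) (toℕ-fromℕ< _) ⟩
      (toℕ i + ((n ∸ toℕ i) + toℕ k) % n) % n ≡⟨ [m+o%n]%n≡[m+o]%n (toℕ i) _ ⟩
      (toℕ i + ((n ∸ toℕ i) + toℕ k)) % n     ≡⟨ [a+[b+k]]%n≡k (toℕ i) (n ∸ toℕ i) k (m+[n∸m]≡n (<⇒≤ (toℕ<n i))) ⟩
      toℕ k                                   ∎)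
      where open ≡-Reasoning

    ⊕≡⇔≡⊖ : ∀ {i j k} → i ⊕ j ≡ k ⇔ j ≡ k ⊖ i
    ⊕≡⇔≡⊖ {i} {j} = mk⇔ (λ { refl → sym (⊕-⊖-cancel i j) }) (λ { refl → ⊖-⊕-cancel i _ })

    cyclic : LatinSquare n
    cyclic = record
      { _∙_ = _⊕_
      ; _\\_ = λ i k → k ⊖ i
      ; _//_ = _⊖_
      ; ∙≡⇔≡\\ = ⊕≡⇔≡⊖
      ; ∙≡⇔≡// = λ {i} {j} → ⊕≡⇔≡⊖ ⇔-∘ mk⇔ (trans (⊕-comm j i)) (trans (⊕-comm i j))
      }

  module _ {n} (L : LatinSquare n) where
    open LatinSquare L

    ∙-cancelˡ : ∀ {i j k} → i ∙ j ≡ i ∙ k → j ≡ k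
    ∙-cancelˡ eq = trans (Equivalence.to ∙≡⇔≡\\ eq) (sym (Equivalence.to ∙≡⇔≡\\ refl))

    ∙-cancelʳ : ∀ {i j k} → i ∙ k ≡ j ∙ k → i ≡ j
    ∙-cancelʳ eq = trans (Equivalence.to ∙≡⇔≡// eq) (sym (Equivalence.to ∙≡⇔≡// refl))

  module _ (q : ℕ) where
    open Cyclic (suc (suc q))

    isotopeFamily : Fin (suc q) × Fin (suc q) × Fin (suc (suc q)) → LatinSquare (suc (suc q))
    isotopeFamily (x , y , c) =
      isotope (transpose (suc zero) (suc x)) (transpose (suc zero) (suc y)) (transpose zero c) cyclic

    -- α and β fix 0 and send 1 to suc x and suc y, and γ sends 0 to c, so the entries at (0,0),
    -- (1,0) and (0,1) are c, γ (suc x ⊕ 0) and γ (0 ⊕ suc y), from which (x, y, c) can be read off.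
    isotopeFamily-injective : ∀ u v → isotopeFamily u ≈ isotopeFamily v → u ≡ v
    isotopeFamily-injective (x , y , c) (x′ , y′ , c′) same with same zero zero
    ... | refl = cong₂ _,_ x≡x′ (cong (_, c) y≡y′)
      where
      γ-injective : ∀ {i j} → transpose zero c ⟨$⟩ʳ i ≡ transpose zero c ⟨$⟩ʳ j → i ≡ j
      γ-injective = Injection.injective (↔⇒↣ (transpose zero c))
      x≡x′ : x ≡ x′
      x≡x′ = suc-injective (∙-cancelʳ cyclic (γ-injective (same (suc zero) zero)))
      y≡y′ : y ≡ y′
      y≡y′ = suc-injective (∙-cancelˡ cyclic {zero} (γ-injective (same zero (suc zero))))

    index↔parameters : Fin (suc q * (suc q * suc (suc q))) ↔ (Fin (suc q) × Fin (suc q) × Fin (suc (suc q)))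
    index↔parameters = (↔-id _ ×-↔ *↔×) ↔-∘ *↔×

    latinSquares : Fin (suc q * (suc q * suc (suc q))) → LatinSquare (suc (suc q))
    latinSquares = isotopeFamily ∘ Inverse.to index↔parameters

    latinSquares-injective : ∀ a b → latinSquares a ≈ latinSquares b → a ≡ b
    latinSquares-injective a b same =
      Injection.injective (↔⇒↣ index↔parameters) (isotopeFamily-injective _ _ same)

module PermutationTensors where
  open import Data.Rational using (ℚ; 0ℚ; 1ℚ; _+_; _*_; _-_; -_; _≤_; _<_; positive; nonNegative)
  open import Data.Rational.Properties
    using ( ≤-refl; ≤-trans; ≤-antisym; ≤-reflexive; <⇒≤; +-comm; +-identityˡ; +-identityʳ; +-inverseʳ
          ; +-monoˡ-≤; +-monoʳ-≤; +-monoˡ-<; *-zeroʳ; *-cancelˡ-≤-pos; nonNeg*nonNeg⇒nonNeg; nonNegative⁻¹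
          ; +-0-group; positive⁻¹)
  open import Data.Rational.Solver using (module +-*-Solver)
  open import Algebra.Properties.Group +-0-group using (x∙y⁻¹≈ε⇒x≈y)
  open import Data.Fin.Properties using (_≟_; 0≢1+n; suc-injective)
  open import Data.Sum using (_⊎_; inj₁; inj₂)
  open import Relation.Nullary using (Dec; yes; no; ¬_; contradiction)
  open import Relation.Unary using (Decidable)
  open LatinSquares

  private
    variable
      p q t x y : ℚ

  p≤p+q : 0ℚ ≤ q → p ≤ p + q
  p≤p+q {q = q} {p = p} 0≤q = subst (_≤ p + q) (+-identityʳ p) (+-monoʳ-≤ p 0≤q)

  p≤q⇒0≤q-p : p ≤ q → 0ℚ ≤ q - p
  p≤q⇒0≤q-p {p = p} {q = q} p≤q = subst (_≤ q - p) (+-inverseʳ p) (+-monoˡ-≤ (- p) p≤q)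

  p<q⇒0<q-p : p < q → 0ℚ < q - p
  p<q⇒0<q-p {p = p} {q = q} p<q = subst (_< q - p) (+-inverseʳ p) (+-monoˡ-< (- p) p<q)

  0≤p*q : 0ℚ ≤ p → 0ℚ ≤ q → 0ℚ ≤ p * q
  0≤p*q {p = p} {q = q} 0≤p 0≤q =
    nonNegative⁻¹ _ {{nonNeg*nonNeg⇒nonNeg p {{nonNegative 0≤p}} q {{nonNegative 0≤q}}}}

  p+q≡0⇒p≡0 : 0ℚ ≤ p → 0ℚ ≤ q → p + q ≡ 0ℚ → p ≡ 0ℚ
  p+q≡0⇒p≡0 {p = p} 0≤p 0≤q p+q≡0 = ≤-antisym (subst (p ≤_) p+q≡0 (p≤p+q 0≤q)) 0≤p

  pos*q≡0⇒q≡0 : 0ℚ < p → p * q ≡ 0ℚ → q ≡ 0ℚ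
  pos*q≡0⇒q≡0 {p = p} 0<p pq≡0 = ≤-antisym
    (*-cancelˡ-≤-pos p {{positive 0<p}} (≤-reflexive pq≡p0))
    (*-cancelˡ-≤-pos p {{positive 0<p}} (≤-reflexive (sym pq≡p0)))
    where pq≡p0 = trans pq≡0 (sym (*-zeroʳ p))

  complement-combination : ∀ t x y → t * (1ℚ - x) + (1ℚ - t) * (1ℚ - y) ≡ 1ℚ - (t * x + (1ℚ - t) * y)
  complement-combination = solve 3 (λ t x y → t :* (con 1ℚ :- x) :+ (con 1ℚ :- t) :* (con 1ℚ :- y)
                                    := con 1ℚ :- (t :* x :+ (con 1ℚ :- t) :* y)) refl
    where open +-*-Solver

  module _ (0<t : 0ℚ < t) (t<1 : t < 1ℚ) where

    convex-≡0 : 0ℚ ≤ x → 0ℚ ≤ y → t * x + (1ℚ - t) * y ≡ 0ℚ → x ≡ 0ℚ × y ≡ 0ℚ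
    convex-≡0 {x = x} {y = y} 0≤x 0≤y eq =
      pos*q≡0⇒q≡0 0<t (p+q≡0⇒p≡0 0≤tx 0≤sy eq) ,
      pos*q≡0⇒q≡0 0<s (p+q≡0⇒p≡0 0≤sy 0≤tx (trans (+-comm ((1ℚ - t) * y) (t * x)) eq))
      where
      0<s = p<q⇒0<q-p t<1
      0≤tx = 0≤p*q (<⇒≤ 0<t) 0≤x
      0≤sy = 0≤p*q (<⇒≤ 0<s) 0≤y

    convex-≡1 : x ≤ 1ℚ → y ≤ 1ℚ → t * x + (1ℚ - t) * y ≡ 1ℚ → x ≡ 1ℚ × y ≡ 1ℚ
    convex-≡1 {x = x} {y = y} x≤1 y≤1 eq =
      sym (x∙y⁻¹≈ε⇒x≈y 1ℚ x (proj₁ complements≡0)) , sym (x∙y⁻¹≈ε⇒x≈y 1ℚ y (proj₂ complements≡0))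
      where
      complements≡0 : 1ℚ - x ≡ 0ℚ × 1ℚ - y ≡ 0ℚ
      complements≡0 = convex-≡0 (p≤q⇒0≤q-p x≤1) (p≤q⇒0≤q-p y≤1)
        (trans (complement-combination t x y) (trans (cong (λ z → 1ℚ - z) eq) (+-inverseʳ 1ℚ)))

  Σℚ-nonNeg : ∀ n {f : Fin n → ℚ} → (∀ i → 0ℚ ≤ f i) → 0ℚ ≤ Σℚ n f
  Σℚ-nonNeg zero    _    = ≤-refl
  Σℚ-nonNeg (suc n) 0≤f = ≤-trans (0≤f zero) (p≤p+q (Σℚ-nonNeg n (0≤f ∘ suc)))

  ≤Σℚ : ∀ n {f : Fin n → ℚ} → (∀ i → 0ℚ ≤ f i) → ∀ i → f i ≤ Σℚ n f
  ≤Σℚ (suc n)     0≤f zero    = p≤p+q (Σℚ-nonNeg n (0≤f ∘ suc))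
  ≤Σℚ (suc n) {f} 0≤f (suc i) = ≤-trans (≤Σℚ n (0≤f ∘ suc) i)
    (subst (_≤ f zero + Σℚ n (f ∘ suc)) (+-identityˡ _) (+-monoˡ-≤ (Σℚ n (f ∘ suc)) (0≤f zero)))

  Σℚ-0 : ∀ n {f : Fin n → ℚ} → (∀ i → f i ≡ 0ℚ) → Σℚ n f ≡ 0ℚ
  Σℚ-0 zero    _   = refl
  Σℚ-0 (suc n) f≡0 = cong₂ _+_ (f≡0 zero) (Σℚ-0 n (f≡0 ∘ suc))

  indicator : ∀ {P : Set} → Dec P → ℚ
  indicator (yes _) = 1ℚ
  indicator (no _)  = 0ℚ

  indicator-yes : ∀ {P : Set} (P? : Dec P) → P → indicator P? ≡ 1ℚ
  indicator-yes (yes _) _ = refl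
  indicator-yes (no ¬p) p = contradiction p ¬p

  indicator-no : ∀ {P : Set} (P? : Dec P) → ¬ P → indicator P? ≡ 0ℚ
  indicator-no (yes p) ¬p = contradiction p ¬p
  indicator-no (no _)  _  = refl

  indicator≡1⇒ : ∀ {P : Set} (P? : Dec P) → indicator P? ≡ 1ℚ → P
  indicator≡1⇒ (yes p) _ = p

  indicator-nonNeg : ∀ {P : Set} (P? : Dec P) → 0ℚ ≤ indicator P?
  indicator-nonNeg (yes _) = <⇒≤ (positive⁻¹ 1ℚ)
  indicator-nonNeg (no _)  = ≤-refl

  indicator-zeroOne : ∀ {P : Set} (P? : Dec P) → indicator P? ≡ 0ℚ ⊎ indicator P? ≡ 1ℚ
  indicator-zeroOne (yes _) = inj₂ refl
  indicator-zeroOne (no _)  = inj₁ refl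

  Σℚ-indicator : ∀ n {P : Fin n → Set} (P? : Decidable P) (c : Fin n) →
                 (∀ {i} → P i ⇔ i ≡ c) → Σℚ n (λ i → indicator (P? i)) ≡ 1ℚ
  Σℚ-indicator (suc n) P? zero    P⇔≡c = cong₂ _+_
    (indicator-yes (P? zero) (Equivalence.from P⇔≡c refl))
    (Σℚ-0 n (λ i → indicator-no (P? (suc i)) (0≢1+n ∘ sym ∘ Equivalence.to P⇔≡c)))
  Σℚ-indicator (suc n) P? (suc c) P⇔≡c = trans
    (cong₂ _+_ (indicator-no (P? zero) (0≢1+n ∘ Equivalence.to P⇔≡c))
               (Σℚ-indicator n (P? ∘ suc) c
                 (mk⇔ (suc-injective ∘ Equivalence.to P⇔≡c) (Equivalence.from P⇔≡c ∘ cong suc))))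
    (+-identityˡ 1ℚ)

  module _ {n : ℕ} where

    entry≤1 : ∀ {A} → IsStochastic n A → ∀ i j k → A i j k ≤ 1ℚ
    entry≤1 {A} (0≤A , _ , _ , Σₖ≡1) i j k = subst (A i j k ≤_) (Σₖ≡1 i j) (≤Σℚ n (0≤A i j) k)

    zeroOne⇒isVertex : ∀ {A} → IsStochastic n A → (∀ i j k → A i j k ≡ 0ℚ ⊎ A i j k ≡ 1ℚ) → IsVertex n A
    zeroOne⇒isVertex {A} stochA zeroOne = stochA , λ B C t stochB stochC 0<t t<1 A≡tB+[1-t]C i j k →
      case zeroOne i j k of λ where
        (inj₁ A≡0) → let (B≡0 , C≡0) = convex-≡0 0<t t<1 (proj₁ stochB i j k) (proj₁ stochC i j k)
                                          (trans (sym (A≡tB+[1-t]C i j k)) A≡0)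
                     in trans B≡0 (sym C≡0)
        (inj₂ A≡1) → let (B≡1 , C≡1) = convex-≡1 0<t t<1 (entry≤1 stochB i j k) (entry≤1 stochC i j k)
                                          (trans (sym (A≡tB+[1-t]C i j k)) A≡1)
                     in trans B≡1 (sym C≡1)

  module _ {n : ℕ} (L : LatinSquare n) where
    open LatinSquare L

    permutationTensor : Tensor n
    permutationTensor i j k = indicator (i ∙ j ≟ k)

    permutationTensor-isStochastic : IsStochastic n permutationTensor
    permutationTensor-isStochastic =
      (λ i j k → indicator-nonNeg (i ∙ j ≟ k)) ,
      (λ j k → Σℚ-indicator n (λ i → i ∙ j ≟ k) (k // j) ∙≡⇔≡//) ,
      (λ i k → Σℚ-indicator n (λ j → i ∙ j ≟ k) (i \\ k) ∙≡⇔≡\\) ,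
      (λ i j → Σℚ-indicator n (λ k → i ∙ j ≟ k) (i ∙ j) (mk⇔ sym sym))

    permutationTensor-isVertex : IsVertex n permutationTensor
    permutationTensor-isVertex =
      zeroOne⇒isVertex permutationTensor-isStochastic (λ i j k → indicator-zeroOne (i ∙ j ≟ k))

  permutationTensor-injective : ∀ {n} (L M : LatinSquare n) → permutationTensor L ≐ permutationTensor M → L ≈ M
  permutationTensor-injective L M same i j = sym (indicator≡1⇒ (i M.∙ j ≟ i L.∙ j)
    (trans (sym (same i j (i L.∙ j))) (indicator-yes (i L.∙ j ≟ i L.∙ j) refl)))
    where
    module L = LatinSquare L
    module M = LatinSquare M

  latinSquares⇒atLeastVertices : ∀ {m n} (L : Fin m → LatinSquare n) →
                                 (∀ a b → L a ≈ L b → a ≡ b) → AtLeastVertices n m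
  latinSquares⇒atLeastVertices L L-injective =
    permutationTensor ∘ L ,
    (λ a → permutationTensor-isVertex (L a)) ,
    (λ a b same → L-injective a b (permutationTensor-injective (L a) (L b) same))

module BinomialBounds where
  open import Data.Bool using (true; false)
  open import Data.Nat using (_+_; _*_; _∸_; _^_; _≤_; _<_; _≤′_; _≤ᵇ_; _≤?_; z≤n; s≤s; ≤′-refl; ≤′-step)
  open import Data.Nat.Properties
    using ( ≤-refl; ≤-trans; ≤⇒≤′; ≤ᵇ⇒≤; ≤⇒≤ᵇ; ≮⇒≥; <⇒≱; n≤1+n; m≤m+n; m≤n+m; m≤m*n
          ; +-suc; +-comm; +-mono-≤; +-monoˡ-≤; +-monoʳ-≤; *-suc; *-assoc; *-distribˡ-+
          ; *-mono-≤; *-monoˡ-≤; *-monoʳ-≤; *-cancelˡ-≤; ∸-monoˡ-≤; m+n∸m≡n; ^-monoˡ-≤; m^n>0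
          ; module ≤-Reasoning)
  open import Data.Nat.Combinatorics using (_C_; nCk+nC[k+1]≡[n+1]C[k+1]; nCk≡nC[n∸k]; nC1≡n)
  open import Data.Nat.Solver using (module +-*-Solver)
  open import Relation.Nullary using (¬_; yes; no; contradiction)
  open +-*-Solver

  nCk≤[1+n]Ck : ∀ n k → n C k ≤ suc n C k
  nCk≤[1+n]Ck n zero    = ≤-refl
  nCk≤[1+n]Ck n (suc k) = subst (n C suc k ≤_) (nCk+nC[k+1]≡[n+1]C[k+1] n k) (m≤n+m _ _)

  C-monoˡ : ∀ {m n} k → m ≤ n → m C k ≤ n C k
  C-monoˡ k = go ∘ ≤⇒≤′
    where
    go : ∀ {m n} → m ≤′ n → m C k ≤ n C k
    go ≤′-refl       = ≤-refl
    go (≤′-step m≤n) = ≤-trans (go m≤n) (nCk≤[1+n]Ck _ k)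

  2*[1+n]C2≡[1+n]*n : ∀ n → 2 * (suc n C 2) ≡ suc n * n
  2*[1+n]C2≡[1+n]*n zero    = refl
  2*[1+n]C2≡[1+n]*n (suc n) = begin
    2 * (suc (suc n) C 2)         ≡⟨ cong (2 *_) (nCk+nC[k+1]≡[n+1]C[k+1] (suc n) 1) ⟨
    2 * (suc n C 1 + suc n C 2)   ≡⟨ cong (λ c → 2 * (c + suc n C 2)) (nC1≡n (suc n)) ⟩
    2 * (suc n + suc n C 2)       ≡⟨ *-distribˡ-+ 2 (suc n) _ ⟩
    2 * suc n + 2 * (suc n C 2)   ≡⟨ cong (2 * suc n +_) (2*[1+n]C2≡[1+n]*n n) ⟩
    2 * suc n + suc n * n         ≡⟨ solve 1 (λ n → con 2 :* (con 1 :+ n) :+ (con 1 :+ n) :* n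
                                                := (con 2 :+ n) :* (con 1 :+ n)) refl n ⟩
    suc (suc n) * suc n           ∎
    where open ≡-Reasoning

  binomShift-≤ : ∀ {m} a b → suc a ≤ m → binomShift m a b ≡ (m ∸ suc a) C b
  binomShift-≤ {m} a b 1+a≤m with suc a ≤ᵇ m | ≤⇒≤ᵇ 1+a≤m
  ... | true | _ = refl

  binomShift-≰ : ∀ {m} a b → ¬ suc a ≤ m → binomShift m a b ≡ 0
  binomShift-≰ {m} a b 1+a≰m with suc a ≤ᵇ m | ≤ᵇ⇒≤ (suc a) m
  ... | true  | 1+a≤m = contradiction (1+a≤m _) 1+a≰m
  ... | false | _     = refl

  binomShift[m,a,0]≤1 : ∀ m a → binomShift m a 0 ≤ 1
  binomShift[m,a,0]≤1 m a with suc a ≤ᵇ m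
  ... | true  = ≤-refl
  ... | false = z≤n

  binomShift-monoˡ : ∀ a b {m m′} → m ≤ m′ → binomShift m a b ≤ binomShift m′ a b
  binomShift-monoˡ a b {m} {m′} m≤m′ with suc a ≤? m
  ... | yes 1+a≤m = begin
    binomShift m a b   ≡⟨ binomShift-≤ a b 1+a≤m ⟩
    (m ∸ suc a) C b    ≤⟨ C-monoˡ b (∸-monoˡ-≤ (suc a) m≤m′) ⟩
    (m′ ∸ suc a) C b   ≡⟨ binomShift-≤ a b (≤-trans 1+a≤m m≤m′) ⟨
    binomShift m′ a b  ∎
    where open ≤-Reasoning
  ... | no 1+a≰m = subst (_≤ binomShift m′ a b) (sym (binomShift-≰ a b 1+a≰m)) z≤n

  binomShift[1+a+t]≡tCb : ∀ a b t → binomShift (suc a + t) a b ≡ t C b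
  binomShift[1+a+t]≡tCb a b t = trans (binomShift-≤ a b (m≤m+n (suc a) t)) (cong (_C b) (m+n∸m≡n (suc a) t))

  u0-monoʳ : ∀ d {m m′} → m ≤ m′ → u0 d m ≤ u0 d m′
  u0-monoʳ d m≤m′ =
    +-mono-≤ (binomShift-monoˡ (half d) (half (d ∸ 1)) m≤m′) (binomShift-monoˡ (half (d ∸ 1)) (half d) m≤m′)

  u0[k∸1]<x≤u0[m]⇒k≤m : ∀ d {k x m} → u0 d (k ∸ 1) < x → x ≤ u0 d m → k ≤ m
  u0[k∸1]<x≤u0[m]⇒k≤m d u0[k∸1]<x x≤u0[m] = ≮⇒≥ λ m<k →
    <⇒≱ u0[k∸1]<x (≤-trans x≤u0[m] (u0-monoʳ d (∸-monoˡ-≤ 1 m<k)))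

  u0[1,m]≤2 : ∀ m → u0 1 m ≤ 2
  u0[1,m]≤2 m = +-mono-≤ (binomShift[m,a,0]≤1 m 0) (binomShift[m,a,0]≤1 m 0)

  half[1+x]+half[x]≡x : ∀ x → half (suc x) + half x ≡ x
  half[1+x]+half[x]≡x zero          = refl
  half[1+x]+half[x]≡x (suc zero)    = refl
  half[1+x]+half[x]≡x (suc (suc x)) =
    cong suc (trans (+-suc (half (suc x)) (half x)) (cong suc (half[1+x]+half[x]≡x x)))

  x≤1+2*half[x] : ∀ x → x ≤ suc (2 * half x)
  x≤1+2*half[x] zero          = z≤n
  x≤1+2*half[x] (suc zero)    = s≤s z≤n
  x≤1+2*half[x] (suc (suc x)) =
    subst (suc (suc x) ≤_) (cong suc (sym (*-suc 2 (half x)))) (s≤s (s≤s (x≤1+2*half[x] x)))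

  d≤2*[1+half[d∸1]] : ∀ d → d ≤ 2 * suc (half (d ∸ 1))
  d≤2*[1+half[d∸1]] zero    = z≤n
  d≤2*[1+half[d∸1]] (suc x) = subst (suc x ≤_) (sym (*-suc 2 (half x))) (s≤s (x≤1+2*half[x] x))

  [2+b]C2≤u0[d][2+d] : ∀ d → 1 ≤ d → (2 + half (d ∸ 1)) C 2 ≤ u0 d (2 + d)
  [2+b]C2≤u0[d][2+d] (suc x) _ = begin
    (2 + b) C 2                      ≡⟨ nCk≡nC[n∸k] (m≤m+n 2 b) ⟩
    (2 + b) C (2 + b ∸ 2)            ≡⟨ cong ((2 + b) C_) (m+n∸m≡n 2 b) ⟩
    (2 + b) C b                      ≡⟨ binomShift[1+a+t]≡tCb a b (2 + b) ⟨
    binomShift (suc a + (2 + b)) a b ≡⟨ cong (λ m → binomShift m a b) 1+a+[2+b]≡2+d ⟩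
    binomShift (2 + suc x) a b       ≤⟨ m≤m+n _ _ ⟩
    u0 (suc x) (2 + suc x)           ∎
    where
    open ≤-Reasoning
    a = half (suc x)
    b = half x
    1+a+[2+b]≡2+d : suc a + (2 + b) ≡ 2 + suc x
    1+a+[2+b]≡2+d = cong suc (trans (+-suc a (suc b))
                                    (cong suc (trans (+-suc a b) (cong suc (half[1+x]+half[x]≡x x)))))

  2[1+p]≤p*p : ∀ {p} → 3 ≤ p → 2 * suc p ≤ p * p
  2[1+p]≤p*p {p} 3≤p = begin
    2 * suc p  ≡⟨ *-suc 2 p ⟩
    2 + 2 * p  ≤⟨ +-monoˡ-≤ (2 * p) (≤-trans (n≤1+n 2) 3≤p) ⟩
    3 * p      ≤⟨ *-monoˡ-≤ p 3≤p ⟩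
    p * p      ∎
    where open ≤-Reasoning

  [1+p]³≤[2+b]C2 : ∀ {p b} → 3 ≤ p → p ^ 3 ≤ 2 * suc b → suc p ^ 3 ≤ (2 + b) C 2
  [1+p]³≤[2+b]C2 {p} {b} 3≤p p³≤2[1+b] = *-cancelˡ-≤ {suc p ^ 3} {(2 + b) C 2} 8 (begin
    8 * suc p ^ 3                ≡⟨ solve 1 (λ x → (con 2 :* x) :^ 3 := con 8 :* x :^ 3) refl (suc p) ⟨
    (2 * suc p) ^ 3              ≤⟨ ^-monoˡ-≤ 3 (2[1+p]≤p*p 3≤p) ⟩
    (p * p) ^ 3                  ≡⟨ solve 1 (λ x → (x :* x) :^ 3 := x :^ 3 :* x :^ 3) refl p ⟩
    p ^ 3 * p ^ 3                ≤⟨ *-mono-≤ p³≤2[1+b] p³≤2[1+b] ⟩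
    2 * suc b * (2 * suc b)      ≡⟨ solve 1 (λ x → con 2 :* x :* (con 2 :* x) := con 4 :* (x :* x)) refl (suc b) ⟩
    4 * (suc b * suc b)          ≤⟨ *-monoʳ-≤ 4 (*-monoˡ-≤ (suc b) (n≤1+n (suc b))) ⟩
    4 * ((2 + b) * suc b)        ≡⟨ cong (4 *_) (2*[1+n]C2≡[1+n]*n (suc b)) ⟨
    4 * (2 * ((2 + b) C 2))      ≡⟨ *-assoc 4 2 ((2 + b) C 2) ⟨
    8 * ((2 + b) C 2)            ∎)
    where open ≤-Reasoning

  n³≤u0[[n∸1]³][[n∸1]²n] : ∀ n → 3 ≤ n → n ^ 3 ≤ u0 ((n ∸ 1) ^ 3) ((n ∸ 1) * ((n ∸ 1) * n))
  n³≤u0[[n∸1]³][[n∸1]²n] 1 (s≤s ())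
  n³≤u0[[n∸1]³][[n∸1]²n] 2 (s≤s (s≤s ()))
  -- For n = 3 the bound C(b + 2, 2) = C(5, 2) is below 27, but u0 8 12 = 105 evaluates.
  n³≤u0[[n∸1]³][[n∸1]²n] 3 _ = ≤ᵇ⇒≤ 27 (u0 8 12) _
  n³≤u0[[n∸1]³][[n∸1]²n] (suc p@(suc (suc (suc _)))) _ = begin
    suc p ^ 3                     ≤⟨ [1+p]³≤[2+b]C2 {p} {b} 3≤p (d≤2*[1+half[d∸1]] (p ^ 3)) ⟩
    (2 + b) C 2                   ≤⟨ [2+b]C2≤u0[d][2+d] (p ^ 3) (m^n>0 p 3) ⟩
    u0 (p ^ 3) (2 + p ^ 3)        ≤⟨ u0-monoʳ (p ^ 3) 2+p³≤p*[p*[1+p]] ⟩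
    u0 (p ^ 3) (p * (p * suc p))  ∎
    where
    open ≤-Reasoning
    b = half (p ^ 3 ∸ 1)
    3≤p : 3 ≤ p
    3≤p = s≤s (s≤s (s≤s z≤n))
    2+p³≤p*[p*[1+p]] : 2 + p ^ 3 ≤ p * (p * suc p)
    2+p³≤p*[p*[1+p]] = begin
      2 + p ^ 3      ≡⟨ +-comm 2 (p ^ 3) ⟩
      p ^ 3 + 2      ≤⟨ +-monoʳ-≤ (p ^ 3) (≤-trans (m≤m*n 2 (suc p)) (2[1+p]≤p*p 3≤p)) ⟩
      p ^ 3 + p * p  ≡⟨ solve 1 (λ x → x :^ 3 :+ x :* x := x :* (x :* (con 1 :+ x))) refl p ⟩
      p * (p * suc p) ∎

open import Data.Nat using (ℕ; _≤_; _<_; _∸_; _^_; _*_; z≤n; s≤s)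
open import Data.Nat.Properties using (≤-trans; <⇒≱)
open import Data.Fin using (inject≤)
open import Data.Fin.Properties using (inject≤-injective)
open import Relation.Nullary using (contradiction)
open LatinSquares using (latinSquares; latinSquares-injective)
open PermutationTensors using (latinSquares⇒atLeastVertices)
open BinomialBounds using (u0[1,m]≤2; u0[k∸1]<x≤u0[m]⇒k≤m; n³≤u0[[n∸1]³][[n∸1]²n])

atLeastVertices-≤ : ∀ {n k m} → k ≤ m → AtLeastVertices n m → AtLeastVertices n k
atLeastVertices-≤ k≤m (v , isVertex , injective) =
  (λ a → v (inject≤ a k≤m)) ,
  (λ a → isVertex (inject≤ a k≤m)) ,
  (λ a b same → inject≤-injective k≤m k≤m a b (injective _ _ same))

theorem5 : (n : ℕ) → 2 ≤ n → (k : ℕ) →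
    u0 ((n ∸ 1) ^ 3) (k ∸ 1) < n ^ 3 → n ^ 3 ≤ u0 ((n ∸ 1) ^ 3) k →
    AtLeastVertices n k
theorem5 1 (s≤s ()) _ _ _
theorem5 2 _ k _ 8≤u0[1,k] = contradiction (≤-trans 8≤u0[1,k] (u0[1,m]≤2 k)) (<⇒≱ (s≤s (s≤s (s≤s z≤n))))
theorem5 n@(suc (suc (suc q))) _ k u0[k∸1]<n³ _ = atLeastVertices-≤ k≤[n∸1]²n [n∸1]²n-vertices
  where
  [n∸1]²n-vertices : AtLeastVertices n ((n ∸ 1) * ((n ∸ 1) * n))
  [n∸1]²n-vertices = latinSquares⇒atLeastVertices (latinSquares (suc q)) (latinSquares-injective (suc q))
  k≤[n∸1]²n : k ≤ (n ∸ 1) * ((n ∸ 1) * n)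
  k≤[n∸1]²n = u0[k∸1]<x≤u0[m]⇒k≤m ((n ∸ 1) ^ 3) u0[k∸1]<n³
    (n³≤u0[[n∸1]³][[n∸1]²n] n (s≤s (s≤s (s≤s z≤n))))
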